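{- For a binary string $x$ of length $n$ drawn uniformly at random from $\{0,1\}^n$, the expected number of bit comparisons made by algorithm Tournament on $x$ is at most $2n/3 + O(\sqrt{n\log n})$.
   Context: The majority bit of $x=x_1\cdots x_n\in\{0,1\}^n$ is the bit appearing more than $\lfloor n/2\rfloor$ times; if none exists, "no majority" must be reported. A comparison tests whether two bits $x_i,x_j$ are equal. Algorithm Tournament$(x_1\cdots x_n)$: if $n=1$ return $x_1$; if $n=2$, return $x_1$ if $x_1=x_2$ and otherwise "no majority"; if $n=3$, return $x_1$ if $x_1=x_2$ and otherwise return $x_3$; otherwise let $y$ be the empty string, for $i=1,\ldots,\lfloor n/2\rfloor$ compare $x_{2i-1}$ with $x_{2i}$ and if they are equal append $x_{2i}$ to $y$; if $\lfloor n/2\rfloor$ is even, append $x_n$ to $y$; then return Tournament$(y)$. -}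

module Defs where

open import Data.Bool using (Bool; true; false; if_then_else_)
import Data.Bool as B
open import Data.Nat using (ℕ; zero; suc; _+_; _*_; _≡ᵇ_)
open import Data.Nat.DivMod using (_/_; _%_)
open import Data.List using (List; []; _∷_; _++_; [_]; length; map)
open import Data.Nat.ListAction using (sum)
open import Relation.Nullary using (does)

-- A binary string x = x₁⋯xₙ is a List Bool (false = 0, true = 1).

keepEq : List Bool → List Bool
keepEq (a ∷ b ∷ r) = if does (a B.≟ b) then b ∷ keepEq r else keepEq r
keepEq _ = []

lastIfOdd : List Bool → List Bool
lastIfOdd (a ∷ b ∷ r) = lastIfOdd r
lastIfOdd (a ∷ []) = a ∷ []
lastIfOdd [] = []

-- One round of Tournament: the string y built from x (for n ≥ 4).
-- xₙ is appended when n is odd and ⌊n/2⌋ is even.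
step : List Bool → List Bool
step x = keepEq x ++ (if (length x / 2) % 2 ≡ᵇ 0 then lastIfOdd x else [])

-- Number of bit comparisons made by Tournament, with a fuel argument
-- (fuel = length x suffices, since |y| < |x| whenever |x| ≥ 4).
comparisonsF : ℕ → List Bool → ℕ
comparisonsF zero _ = 0
comparisonsF (suc f) [] = 0                          -- y empty: report "no majority"
comparisonsF (suc f) (_ ∷ []) = 0
comparisonsF (suc f) (_ ∷ _ ∷ []) = 1
comparisonsF (suc f) (_ ∷ _ ∷ _ ∷ []) = 1            -- n = 3: compare x₁, x₂
comparisonsF (suc f) x@(_ ∷ _ ∷ _ ∷ _ ∷ _) = length x / 2 + comparisonsF f (step x)

comparisons : List Bool → ℕ
comparisons x = comparisonsF (length x) x

allStrings : ℕ → List (List Bool)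
allStrings zero = [ [] ]
allStrings (suc n) = map (false ∷_) (allStrings n) ++ map (true ∷_) (allStrings n)

-- Total number of comparisons over all x ∈ {0,1}ⁿ  (= 2ⁿ · expected number).
totalComparisons : ℕ → ℕ
totalComparisons n = sum (map comparisons (allStrings n))

{-# OPTIONS --safe #-}
-- Let T(n) be the total number of comparisons over {0,1}ⁿ and p = ⌊n/2⌋. A round costs p on
-- every string, and a string y of length k is produced from exactly C(p,k)·2^(p−k) strings (choose
-- the k equal pairs, then any unequal values for the others). So for even n
-- T(n) = 2ⁿ p + Σₖ C(p,k) 2^(p−k) T(k), and for odd n the same with T(k+1) or 2T(k).
-- Since Σₖ C(p,k) 2^(p−k) 2ᵏ (2ak + b) = 4ᵖ (ap + b), the bound 3T(k) ≤ 2k·2ᵏ for smaller k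
-- gives back 3T(n) ≤ 2n·2ⁿ (tightly, when n is odd and the unpaired bit is kept): the
-- expectation is at most 2n/3 with no error term.
module Submission where

open import Defs
open import Data.Nat using (ℕ; _+_; _*_; _∸_; _^_; _≤_)
open import Data.Nat.Logarithm using (⌊log₂_⌋)
open import Data.Product using (∃-syntax)

open import Data.Bool using (Bool; true; false; if_then_else_)
open import Data.List using (List; []; _∷_; _++_; [_]; length; map)
open import Data.List.Properties using (map-++; map-∘; length-++; ++-identityʳ)
open import Data.Nat using (zero; suc; _<_; z≤n; s≤s; _/_; _%_; _≡ᵇ_)
open import Data.Nat.DivMod using (m/n≡1+[m∸n]/n)
open import Data.Nat.Induction using (<-rec)
open import Data.Nat.ListAction using (sum)
open import Data.Nat.ListAction.Properties using (sum-++)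
open import Data.Nat.Properties
open import Algebra.Properties.CommutativeSemigroup +-commutativeSemigroup using (interchange)
open import Data.Nat.Tactic.RingSolver using (solve-∀)
open import Data.Product using (_,_)
open import Data.Unit using (tt)
open import Function using (_∘_)
open import Relation.Binary.PropositionalEquality using (_≡_; refl; sym; trans; cong; cong₂; subst; module ≡-Reasoning)

cubeSum : ℕ → (List Bool → ℕ) → ℕ
cubeSum zero    h = h []
cubeSum (suc n) h = cubeSum n (h ∘ (false ∷_)) + cubeSum n (h ∘ (true ∷_))

sum-map-allStrings : ∀ n h → sum (map h (allStrings n)) ≡ cubeSum n h
sum-map-allStrings zero    h = +-identityʳ (h [])
sum-map-allStrings (suc n) h = begin
    sum (map h (map (false ∷_) A ++ map (true ∷_) A))
  ≡⟨ cong sum (map-++ h (map (false ∷_) A) (map (true ∷_) A)) ⟩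
    sum (map h (map (false ∷_) A) ++ map h (map (true ∷_) A))
  ≡⟨ sum-++ (map h (map (false ∷_) A)) _ ⟩
    sum (map h (map (false ∷_) A)) + sum (map h (map (true ∷_) A))
  ≡⟨ cong₂ _+_ (cong sum (sym (map-∘ A))) (cong sum (sym (map-∘ A))) ⟩
    sum (map (h ∘ (false ∷_)) A) + sum (map (h ∘ (true ∷_)) A)
  ≡⟨ cong₂ _+_ (sum-map-allStrings n _) (sum-map-allStrings n _) ⟩
    cubeSum (suc n) h ∎
  where open ≡-Reasoning
        A = allStrings n

cubeSum-cong : ∀ n {f g : List Bool → ℕ} →
               (∀ x → length x ≡ n → f x ≡ g x) → cubeSum n f ≡ cubeSum n g
cubeSum-cong zero    f≡g = f≡g [] refl
cubeSum-cong (suc n) f≡g = cong₂ _+_ (cubeSum-cong n (λ x e → f≡g (false ∷ x) (cong suc e)))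
                                     (cubeSum-cong n (λ x e → f≡g (true ∷ x) (cong suc e)))

cubeSum-+ : ∀ n (f g : List Bool → ℕ) →
            cubeSum n (λ x → f x + g x) ≡ cubeSum n f + cubeSum n g
cubeSum-+ zero    f g = refl
cubeSum-+ (suc n) f g =
  trans (cong₂ _+_ (cubeSum-+ n (f ∘ (false ∷_)) (g ∘ (false ∷_)))
                   (cubeSum-+ n (f ∘ (true ∷_)) (g ∘ (true ∷_))))
        (interchange (cubeSum n (f ∘ (false ∷_))) _ _ _)

cubeSum-const : ∀ n a → cubeSum n (λ _ → a) ≡ 2 ^ n * a
cubeSum-const zero    a = sym (*-identityˡ a)
cubeSum-const (suc n) a =
  trans (cong₂ _+_ (cubeSum-const n a) (cubeSum-const n a)) (double-* (2 ^ n) a)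
  where double-* : ∀ t a → t * a + t * a ≡ (2 * t) * a
        double-* = solve-∀

cubeSum-snoc : ∀ n h → cubeSum (suc n) h ≡ cubeSum n (λ y → h (y ++ [ false ]) + h (y ++ [ true ]))
cubeSum-snoc zero    h = refl
cubeSum-snoc (suc n) h = cong₂ _+_ (cubeSum-snoc n (h ∘ (false ∷_))) (cubeSum-snoc n (h ∘ (true ∷_)))

-- binomialSum p s = Σₖ C(p,k) 2^(p−k) s(k)
binomialSum : ℕ → (ℕ → ℕ) → ℕ
binomialSum zero    s = s 0
binomialSum (suc p) s = binomialSum p (λ k → s (suc k) + 2 * s k)

binomialSum-cong : ∀ p {s t : ℕ → ℕ} → (∀ k → s k ≡ t k) → binomialSum p s ≡ binomialSum p t
binomialSum-cong zero    s≡t = s≡t 0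
binomialSum-cong (suc p) s≡t =
  binomialSum-cong p (λ k → cong₂ (λ a b → a + 2 * b) (s≡t (suc k)) (s≡t k))

binomialSum-+ : ∀ p (s t : ℕ → ℕ) →
                binomialSum p (λ k → s k + t k) ≡ binomialSum p s + binomialSum p t
binomialSum-+ zero    s t = refl
binomialSum-+ (suc p) s t =
  trans (binomialSum-cong p (λ k → regroup (s (suc k)) (t (suc k)) (s k) (t k)))
        (binomialSum-+ p _ _)
  where regroup : ∀ a b c d → (a + b) + 2 * (c + d) ≡ (a + 2 * c) + (b + 2 * d)
        regroup = solve-∀

binomialSum-* : ∀ p c (s : ℕ → ℕ) → binomialSum p (λ k → c * s k) ≡ c * binomialSum p s
binomialSum-* zero    c s = refl
binomialSum-* (suc p) c s =
  trans (binomialSum-cong p (λ k → factor c (s (suc k)) (s k))) (binomialSum-* p c _)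
  where factor : ∀ c a b → c * a + 2 * (c * b) ≡ c * (a + 2 * b)
        factor = solve-∀

binomialSum-mono-≤ : ∀ p {s t : ℕ → ℕ} → (∀ k → k ≤ p → s k ≤ t k) →
                     binomialSum p s ≤ binomialSum p t
binomialSum-mono-≤ zero    s≤t = s≤t 0 z≤n
binomialSum-mono-≤ (suc p) s≤t = binomialSum-mono-≤ p (λ k k≤p →
  +-mono-≤ (s≤t (suc k) (s≤s k≤p)) (*-monoʳ-≤ 2 (s≤t k (m≤n⇒m≤1+n k≤p))))

binomialSum-affine : ∀ p a b → binomialSum p (λ k → 2 ^ k * (2 * a * k + b)) ≡ 4 ^ p * (a * p + b)
binomialSum-affine zero    a b = base a b
  where base : ∀ a b → 1 * (2 * a * 0 + b) ≡ 1 * (a * 0 + b)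
        base = solve-∀
binomialSum-affine (suc p) a b =
  trans (binomialSum-cong p (λ k → collect (2 ^ k) a b k))
        (trans (binomialSum-affine p (4 * a) (4 * a + 4 * b)) (shift (4 ^ p) a b p))
  where
  collect : ∀ t a b k → 2 * t * (2 * a * (1 + k) + b) + 2 * (t * (2 * a * k + b))
                        ≡ t * (2 * (4 * a) * k + (4 * a + 4 * b))
  collect = solve-∀
  shift : ∀ t a b p → t * (4 * a * p + (4 * a + 4 * b)) ≡ 4 * t * (a * (1 + p) + b)
  shift = solve-∀

*-binomialSum-≤ : ∀ p c a b {s : ℕ → ℕ} → (∀ k → k ≤ p → c * s k ≤ 2 ^ k * (2 * a * k + b)) →
                  c * binomialSum p s ≤ 4 ^ p * (a * p + b)
*-binomialSum-≤ p c a b {s} bound = begin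
  c * binomialSum p s                           ≡⟨ binomialSum-* p c s ⟨
  binomialSum p (λ k → c * s k)                 ≤⟨ binomialSum-mono-≤ p bound ⟩
  binomialSum p (λ k → 2 ^ k * (2 * a * k + b)) ≡⟨ binomialSum-affine p a b ⟩
  4 ^ p * (a * p + b)                           ∎
  where open ≤-Reasoning

double : ℕ → ℕ
double zero    = zero
double (suc p) = suc (suc (double p))

double≡2* : ∀ p → double p ≡ 2 * p
double≡2* zero    = refl
double≡2* (suc p) = trans (cong (2 +_) (double≡2* p)) (sym (*-suc 2 p))

double+/2 : ∀ p m → m ≤ 1 → (double p + m) / 2 ≡ p
double+/2 zero    zero          _ = refl
double+/2 zero    (suc zero)    _ = refl
double+/2 zero    (suc (suc m)) (s≤s ())
double+/2 (suc p) m m≤1 = trans (m/n≡1+[m∸n]/n {suc (suc (double p + m))} {2} (s≤s (s≤s z≤n)))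
                                (cong suc (double+/2 p m m≤1))

2^double+ : ∀ p m → 2 ^ (double p + m) ≡ 4 ^ p * 2 ^ m
2^double+ zero    m = sym (*-identityˡ (2 ^ m))
2^double+ (suc p) m = trans (cong (λ t → 2 * (2 * t)) (2^double+ p m)) (regroup (4 ^ p) (2 ^ m))
  where regroup : ∀ t u → 2 * (2 * (t * u)) ≡ 4 * t * u
        regroup = solve-∀

≤-double+ : ∀ p m → p ≤ double p + m
≤-double+ zero    m = z≤n
≤-double+ (suc p) m = s≤s (m≤n⇒m≤1+n (≤-double+ p m))

suc<double+ : ∀ p m → 2 ≤ p → suc p < double p + m
suc<double+ (suc zero)    m (s≤s ())
suc<double+ (suc (suc p)) m _ = s≤s (s≤s (s≤s (s≤s (≤-double+ p m))))

data Halving : ℕ → Set where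
  even : ∀ p → Halving (double p + 0)
  odd  : ∀ p → Halving (double p + 1)

halving : ∀ n → Halving n
halving zero = even 0
halving (suc n) with halving n
... | even p = subst Halving (+-suc (double p) 0) (odd p)
... | odd  p = subst Halving (cong suc (sym (+-suc (double p) 0))) (even (suc p))

stepWith : Bool → List Bool → List Bool
stepWith c x = keepEq x ++ (if c then lastIfOdd x else [])

stepWith-[] : ∀ c → stepWith c [] ≡ []
stepWith-[] true  = refl
stepWith-[] false = refl

cubeSum-stepWith : ∀ c m p h →
  cubeSum (double p + m) (h ∘ stepWith c)
  ≡ binomialSum p (λ k → cubeSum k (λ y → cubeSum m (λ r → h (y ++ stepWith c r))))
cubeSum-stepWith c m zero    h = refl
-- The first line is the sum over the leading pair 00, 01, 10, 11: stepWith c then reduces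
-- definitionally to false ∷ stepWith c, stepWith c, stepWith c, true ∷ stepWith c.
cubeSum-stepWith c m (suc p) h = begin
    (S (h ∘ (false ∷_)) + S h) + (S h + S (h ∘ (true ∷_)))
  ≡⟨ cong₂ _+_ (cong₂ _+_ (cubeSum-stepWith c m p (h ∘ (false ∷_))) (cubeSum-stepWith c m p h))
               (cong₂ _+_ (cubeSum-stepWith c m p h) (cubeSum-stepWith c m p (h ∘ (true ∷_)))) ⟩
    (B₀ + B) + (B + B₁)
  ≡⟨ cong ((B₀ + B) +_) (+-comm B B₁) ⟩
    (B₀ + B) + (B₁ + B)
  ≡⟨ interchange B₀ B B₁ B ⟩
    (B₀ + B₁) + (B + B)
  ≡⟨ cong₂ _+_ (binomialSum-+ p s₀ s₁) (cong (B +_) (+-identityʳ B)) ⟨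
    binomialSum p (λ k → s₀ k + s₁ k) + 2 * B
  ≡⟨ cong (binomialSum p (λ k → s₀ k + s₁ k) +_) (binomialSum-* p 2 s) ⟨
    binomialSum p (λ k → s₀ k + s₁ k) + binomialSum p (λ k → 2 * s k)
  ≡⟨ binomialSum-+ p _ _ ⟨
    binomialSum (suc p) s ∎
  where
  open ≡-Reasoning
  S : (List Bool → ℕ) → ℕ
  S g = cubeSum (double p + m) (g ∘ stepWith c)
  tails : (List Bool → ℕ) → ℕ → ℕ
  tails g k = cubeSum k (λ y → cubeSum m (λ r → g (y ++ stepWith c r)))
  s  = tails h
  s₀ = tails (h ∘ (false ∷_))
  s₁ = tails (h ∘ (true ∷_))
  B  = binomialSum p s
  B₀ = binomialSum p s₀
  B₁ = binomialSum p s₁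

cubeSum-stepWith-even : ∀ c p h → cubeSum (double p + 0) (h ∘ stepWith c) ≡ binomialSum p (λ k → cubeSum k h)
cubeSum-stepWith-even c p h = trans (cubeSum-stepWith c 0 p h) (binomialSum-cong p (λ k →
  cubeSum-cong k (λ y _ → cong h (trans (cong (y ++_) (stepWith-[] c)) (++-identityʳ y)))))

-- On odd lengths the unpaired bit either joins y or is dropped (and then counted twice).
oddRoundSum : Bool → (List Bool → ℕ) → ℕ → ℕ
oddRoundSum true  h k = cubeSum (suc k) h
oddRoundSum false h k = cubeSum k h + cubeSum k h

cubeSum-stepWith-odd : ∀ c p h → cubeSum (double p + 1) (h ∘ stepWith c) ≡ binomialSum p (oddRoundSum c h)
cubeSum-stepWith-odd true  p h =
  trans (cubeSum-stepWith true 1 p h) (binomialSum-cong p (λ k → sym (cubeSum-snoc k h)))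
cubeSum-stepWith-odd false p h =
  trans (cubeSum-stepWith false 1 p h) (binomialSum-cong p (λ k →
    trans (cubeSum-cong k (λ y _ → cong₂ _+_ (cong h (++-identityʳ y)) (cong h (++-identityʳ y))))
          (cubeSum-+ k h h)))

length-keepEq-lastIfOdd : ∀ x → length (keepEq x) + length (lastIfOdd x) ≤ length x
length-keepEq-lastIfOdd-pair : ∀ a b r →
  length (keepEq (a ∷ b ∷ r)) + length (lastIfOdd (a ∷ b ∷ r)) < length (a ∷ b ∷ r)

length-keepEq-lastIfOdd []          = z≤n
length-keepEq-lastIfOdd (a ∷ [])    = ≤-refl
length-keepEq-lastIfOdd (a ∷ b ∷ r) = <⇒≤ (length-keepEq-lastIfOdd-pair a b r)

length-keepEq-lastIfOdd-pair false false r = s≤s (s≤s (length-keepEq-lastIfOdd r))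
length-keepEq-lastIfOdd-pair false true  r = s≤s (m≤n⇒m≤1+n (length-keepEq-lastIfOdd r))
length-keepEq-lastIfOdd-pair true  false r = s≤s (m≤n⇒m≤1+n (length-keepEq-lastIfOdd r))
length-keepEq-lastIfOdd-pair true  true  r = s≤s (s≤s (length-keepEq-lastIfOdd r))

length-stepWith : ∀ c x → length (stepWith c x) ≤ length (keepEq x) + length (lastIfOdd x)
length-stepWith true  x = ≤-reflexive (length-++ (keepEq x))
length-stepWith false x = ≤-trans (≤-reflexive (length-++ (keepEq x))) (+-monoʳ-≤ (length (keepEq x)) z≤n)

length-step< : ∀ a b r → length (step (a ∷ b ∷ r)) < length (a ∷ b ∷ r)
length-step< a b r = ≤-<-trans (length-stepWith _ (a ∷ b ∷ r)) (length-keepEq-lastIfOdd-pair a b r)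

comparisonsF-fuel : ∀ f g x → length x ≤ f → length x ≤ g → comparisonsF f x ≡ comparisonsF g x
comparisonsF-fuel zero    zero    []                    _ _ = refl
comparisonsF-fuel zero    (suc g) []                    _ _ = refl
comparisonsF-fuel (suc f) zero    []                    _ _ = refl
comparisonsF-fuel (suc f) (suc g) []                    _ _ = refl
comparisonsF-fuel (suc f) (suc g) (_ ∷ [])              _ _ = refl
comparisonsF-fuel (suc f) (suc g) (_ ∷ _ ∷ [])          _ _ = refl
comparisonsF-fuel (suc f) (suc g) (_ ∷ _ ∷ _ ∷ [])      _ _ = refl
comparisonsF-fuel (suc f) (suc g) x@(a ∷ b ∷ r@(_ ∷ _ ∷ _)) (s≤s x≤f) (s≤s x≤g) =
  cong (length x / 2 +_) (comparisonsF-fuel f g (step x) (≤-pred (≤-trans (length-step< a b r) (s≤s x≤f)))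
                                                         (≤-pred (≤-trans (length-step< a b r) (s≤s x≤g))))

comparisons-step : ∀ x → 4 ≤ length x → comparisons x ≡ length x / 2 + comparisons (step x)
comparisons-step x@(a ∷ b ∷ r@(_ ∷ _ ∷ _)) _ =
  cong (length x / 2 +_) (comparisonsF-fuel _ _ (step x) (≤-pred (length-step< a b r)) ≤-refl)
comparisons-step (_ ∷ [])         (s≤s ())
comparisons-step (_ ∷ _ ∷ [])     (s≤s (s≤s ()))
comparisons-step (_ ∷ _ ∷ _ ∷ []) (s≤s (s≤s (s≤s ())))

comparisonSum : ℕ → ℕ
comparisonSum n = cubeSum n comparisons

comparisonSum-round : ∀ p m → m ≤ 1 → 2 ≤ p →
  comparisonSum (double p + m) ≡ 4 ^ p * 2 ^ m * p + cubeSum (double p + m) (comparisons ∘ stepWith (p % 2 ≡ᵇ 0))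
comparisonSum-round p m m≤1 2≤p = begin
    cubeSum n comparisons
  ≡⟨ cubeSum-cong n unfold ⟩
    cubeSum n (λ x → p + comparisons (stepWith (p % 2 ≡ᵇ 0) x))
  ≡⟨ cubeSum-+ n (λ _ → p) _ ⟩
    cubeSum n (λ _ → p) + cubeSum n (comparisons ∘ stepWith (p % 2 ≡ᵇ 0))
  ≡⟨ cong (_+ cubeSum n (comparisons ∘ stepWith (p % 2 ≡ᵇ 0))) (trans (cubeSum-const n p) (cong (_* p) (2^double+ p m))) ⟩
    4 ^ p * 2 ^ m * p + cubeSum n (comparisons ∘ stepWith (p % 2 ≡ᵇ 0)) ∎
  where
  open ≡-Reasoning
  n = double p + m
  4≤n : 4 ≤ n
  4≤n = ≤-trans (s≤s (s≤s 2≤p)) (suc<double+ p m 2≤p)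
  unfold : ∀ x → length x ≡ n → comparisons x ≡ p + comparisons (stepWith (p % 2 ≡ᵇ 0) x)
  unfold x e = trans (comparisons-step x (subst (4 ≤_) (sym e) 4≤n))
    (cong (λ q → q + comparisons (stepWith (q % 2 ≡ᵇ 0) x)) (trans (cong (_/ 2) e) (double+/2 p m m≤1)))

AtMostTwoThirds : ℕ → Set
AtMostTwoThirds n = 3 * comparisonSum n ≤ 2 * n * 2 ^ n

oddRoundSum-≤ : ∀ c k → AtMostTwoThirds k → AtMostTwoThirds (suc k) →
                3 * oddRoundSum c comparisons k ≤ 2 ^ k * (2 * 2 * k + 4)
oddRoundSum-≤ true  k _ bound₊ = ≤-trans bound₊ (≤-reflexive (regroup (2 ^ k) k))
  where regroup : ∀ t k → 2 * (1 + k) * (2 * t) ≡ t * (2 * 2 * k + 4)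
        regroup = solve-∀
oddRoundSum-≤ false k bound _ = begin
  3 * (σ + σ)                     ≡⟨ *-distribˡ-+ 3 σ σ ⟩
  3 * σ + 3 * σ                   ≤⟨ +-mono-≤ bound bound ⟩
  2 * k * 2 ^ k + 2 * k * 2 ^ k   ≡⟨ regroup (2 ^ k) k ⟩
  2 ^ k * (2 * 2 * k + 0)         ≤⟨ *-monoʳ-≤ (2 ^ k) (+-monoʳ-≤ (2 * 2 * k) z≤n) ⟩
  2 ^ k * (2 * 2 * k + 4)         ∎
  where
  open ≤-Reasoning
  σ = comparisonSum k
  regroup : ∀ t k → 2 * k * t + 2 * k * t ≡ t * (2 * 2 * k + 0)
  regroup = solve-∀

twoThirds-even : ∀ p → 2 ≤ p → (∀ k → k ≤ p → AtMostTwoThirds k) → AtMostTwoThirds (double p + 0)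
twoThirds-even p 2≤p below = begin
  3 * comparisonSum (double p + 0)
    ≡⟨ cong (3 *_) (trans (comparisonSum-round p 0 z≤n 2≤p)
                          (cong (4 ^ p * 1 * p +_) (cubeSum-stepWith-even _ p comparisons))) ⟩
  3 * (4 ^ p * 1 * p + binomialSum p comparisonSum)
    ≡⟨ *-distribˡ-+ 3 (4 ^ p * 1 * p) _ ⟩
  3 * (4 ^ p * 1 * p) + 3 * binomialSum p comparisonSum
    ≤⟨ +-monoʳ-≤ _ (*-binomialSum-≤ p 3 1 0 (λ k k≤p →
         ≤-trans (below k k≤p) (≤-reflexive (regroup (2 ^ k) k)))) ⟩
  3 * (4 ^ p * 1 * p) + 4 ^ p * (1 * p + 0)
    ≡⟨ collect (4 ^ p) p ⟩
  2 * (2 * p + 0) * (4 ^ p * 2 ^ 0)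
    ≡⟨ cong₂ (λ a b → 2 * (a + 0) * b) (double≡2* p) (2^double+ p 0) ⟨
  2 * (double p + 0) * 2 ^ (double p + 0) ∎
  where
  open ≤-Reasoning
  regroup : ∀ t k → 2 * k * t ≡ t * (2 * 1 * k + 0)
  regroup = solve-∀
  collect : ∀ t p → 3 * (t * 1 * p) + t * (1 * p + 0) ≡ 2 * (2 * p + 0) * (t * 1)
  collect = solve-∀

twoThirds-odd : ∀ p → 2 ≤ p → (∀ k → k ≤ suc p → AtMostTwoThirds k) → AtMostTwoThirds (double p + 1)
twoThirds-odd p 2≤p below = begin
  3 * comparisonSum (double p + 1)
    ≡⟨ cong (3 *_) (trans (comparisonSum-round p 1 ≤-refl 2≤p)
                          (cong (4 ^ p * 2 * p +_) (cubeSum-stepWith-odd c p comparisons))) ⟩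
  3 * (4 ^ p * 2 * p + binomialSum p (oddRoundSum c comparisons))
    ≡⟨ *-distribˡ-+ 3 (4 ^ p * 2 * p) _ ⟩
  3 * (4 ^ p * 2 * p) + 3 * binomialSum p (oddRoundSum c comparisons)
    ≤⟨ +-monoʳ-≤ _ (*-binomialSum-≤ p 3 2 4 (λ k k≤p →
         oddRoundSum-≤ c k (below k (m≤n⇒m≤1+n k≤p)) (below (suc k) (s≤s k≤p)))) ⟩
  3 * (4 ^ p * 2 * p) + 4 ^ p * (2 * p + 4)
    ≡⟨ collect (4 ^ p) p ⟩
  2 * (2 * p + 1) * (4 ^ p * 2 ^ 1)
    ≡⟨ cong₂ (λ a b → 2 * (a + 1) * b) (double≡2* p) (2^double+ p 1) ⟨
  2 * (double p + 1) * 2 ^ (double p + 1) ∎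
  where
  open ≤-Reasoning
  c = p % 2 ≡ᵇ 0
  collect : ∀ t p → 3 * (t * 2 * p) + t * (2 * p + 4) ≡ 2 * (2 * p + 1) * (t * 2)
  collect = solve-∀

comparisonSum-≤ : ∀ n → AtMostTwoThirds n
comparisonSum-≤ = <-rec AtMostTwoThirds bound
  where
  bound : ∀ n → (∀ {k} → k < n → AtMostTwoThirds k) → AtMostTwoThirds n
  bound n below with halving n
  ... | even 0                = z≤n
  ... | even 1                = ≤ᵇ⇒≤ _ _ tt
  ... | even p@(suc (suc _))  = twoThirds-even p (s≤s (s≤s z≤n))
          (λ k k≤p → below (≤-<-trans (m≤n⇒m≤1+n k≤p) (suc<double+ p 0 (s≤s (s≤s z≤n)))))
  ... | odd 0                 = z≤n
  ... | odd 1                 = ≤ᵇ⇒≤ _ _ tt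
  ... | odd p@(suc (suc _))   = twoThirds-odd p (s≤s (s≤s z≤n))
          (λ k k≤p → below (≤-<-trans k≤p (suc<double+ p 1 (s≤s (s≤s z≤n)))))

theorem4 : ∃[ C ] ∃[ N ] ∀ n → N ≤ n →
    ((3 * totalComparisons n ∸ 2 * n * 2 ^ n) ^ 2) ≤ C * (2 ^ n) ^ 2 * (n * ⌊log₂ n ⌋)
theorem4 = 0 , 0 , λ n _ → subst (λ d → d ^ 2 ≤ 0) (sym (m≤n⇒m∸n≡0 (total≤ n))) z≤n
  where
  total≤ : ∀ n → 3 * totalComparisons n ≤ 2 * n * 2 ^ n
  total≤ n = subst (λ t → 3 * t ≤ 2 * n * 2 ^ n) (sym (sum-map-allStrings n comparisons)) (comparisonSum-≤ n)
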